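{- Let $n,g$ be integers with $1\leq g\leq \left\lfloor \frac{n-3}{2}\right\rfloor$. Let $T'$ and $T''$ be trees with $|V(T')|=|V(T'')|=g+1$, let $r\ge 0$ and let $T_1,\ldots,T_r$ be trees with $1\le |V(T_i)|\leq g$ for each $i$ and $\sum_{i=1}^r|V(T_i)|=n-2g-3$ (all these trees vertex-disjoint). Let $T_n^*$ be the tree of order $n$ obtained from $T',T'',T_1,\ldots,T_r$ by adding a new vertex $v$ and adding exactly one edge from $v$ to a vertex of each of $T',T'',T_1,\ldots,T_r$. Then $$\kappa_g(T_n^*)=n-2g-2.$$
   Context: A set $S$ of vertices is a cutset if $G-S$ is disconnected; for a non-negative integer $g$, a cutset is an $R_g$-cutset if every component of $G-S$ has at least $g+1$ vertices. If $G$ has an $R_g$-cutset, $\kappa_g(G)$ is the minimum cardinality of an $R_g$-cutset of $G$. -}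

module Defs where

open import Data.Nat using (ℕ; zero; suc; _+_; _≤_)
open import Data.Fin using (Fin; zero; suc; splitAt)
open import Data.Fin.Subset using (Subset; _∈_; _∉_; ∣_∣) renaming (⊥ to ∅)
open import Data.List using (List; []; _∷_; _++_; [_]; length; map)
open import Data.Nat.ListAction using (sum)
open import Data.List.Relation.Unary.Unique.Propositional using (Unique)
open import Data.Sum using (_⊎_; inj₁; inj₂)
open import Data.Product using (Σ; _×_; _,_; ∃)
open import Data.Empty using (⊥)
open import Data.Unit using (⊤)
open import Relation.Nullary using (¬_)
open import Relation.Binary.PropositionalEquality using (_≡_)

record Graph (n : ℕ) : Set₁ where
  field
    Adj    : Fin n → Fin n → Set
    sym    : ∀ {x y} → Adj x y → Adj y x
    irrefl : ∀ {x} → ¬ Adj x x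
open Graph public

data Reach {n : ℕ} (G : Graph n) (S : Subset n) : Fin n → Fin n → Set where
  here : ∀ {x} → x ∉ S → Reach G S x x
  step : ∀ {x y z} → x ∉ S → Adj G x y → Reach G S y z → Reach G S x z

Connected : ∀ {n} → Graph n → Set
Connected G = ∀ x y → Reach G ∅ x y

Chain : ∀ {n} → Graph n → List (Fin n) → Set
Chain G []           = ⊤
Chain G (x ∷ [])     = ⊤
Chain G (x ∷ y ∷ xs) = Adj G x y × Chain G (y ∷ xs)

HasCycle : ∀ {n} → Graph n → Set
HasCycle G = Σ _ λ x → Σ _ λ xs →
  (2 ≤ length xs) × Unique (x ∷ xs) × Chain G (x ∷ xs ++ [ x ])

IsTree : ∀ {n} → Graph n → Set
IsTree G = Connected G × ¬ HasCycle G

IsCutset : ∀ {n} → Graph n → Subset n → Set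
IsCutset G S = Σ _ λ x → Σ _ λ y → x ∉ S × y ∉ S × ¬ Reach G S x y

-- every component of G - S has at least g+1 vertices: the component of any
-- x ∉ S (the vertices reachable from x in G - S) contains ≥ g+1 vertices
IsRgCutset : ∀ {n} → ℕ → Graph n → Subset n → Set
IsRgCutset g G S = IsCutset G S ×
  (∀ x → x ∉ S → Σ (Subset _) λ C → (suc g ≤ ∣ C ∣) × (∀ y → y ∈ C → Reach G S x y))

Kappa : ∀ {n} → ℕ → Graph n → ℕ → Set
Kappa g G m =
  (Σ (Subset _) λ S → IsRgCutset g G S × ∣ S ∣ ≡ m) ×
  (∀ S → IsRgCutset g G S → m ≤ ∣ S ∣)

-- a graph with a distinguished vertex (the vertex to be joined to v)
record Rooted : Set₁ where
  field
    size  : ℕ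
    graph : Graph size
    root  : Fin size
open Rooted public

record AGraph (n : ℕ) : Set₁ where
  field
    gr  : Graph n
    Att : Fin n → Set
open AGraph public

private
  adj⊎ : ∀ {m k} → Graph m → Graph k → Fin m ⊎ Fin k → Fin m ⊎ Fin k → Set
  adj⊎ G H (inj₁ a) (inj₁ b) = Adj G a b
  adj⊎ G H (inj₂ a) (inj₂ b) = Adj H a b
  adj⊎ G H (inj₁ a) (inj₂ b) = ⊥
  adj⊎ G H (inj₂ a) (inj₁ b) = ⊥

  sym⊎ : ∀ {m k} (G : Graph m) (H : Graph k) p q → adj⊎ G H p q → adj⊎ G H q p
  sym⊎ G H (inj₁ a) (inj₁ b) e = sym G e
  sym⊎ G H (inj₂ a) (inj₂ b) e = sym H e

  irr⊎ : ∀ {m k} (G : Graph m) (H : Graph k) p → ¬ adj⊎ G H p p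
  irr⊎ G H (inj₁ a) = irrefl G
  irr⊎ G H (inj₂ a) = irrefl H

  att⊎ : ∀ {m k} → (Fin m → Set) → (Fin k → Set) → Fin m ⊎ Fin k → Set
  att⊎ A B (inj₁ a) = A a
  att⊎ A B (inj₂ b) = B b

-- vertex-disjoint union (vertices of the first graph come first)
_⊕_ : ∀ {m k} → AGraph m → AGraph k → AGraph (m + k)
_⊕_ {m} A B = record
  { gr  = record
    { Adj    = λ x y → adj⊎ (gr A) (gr B) (splitAt m x) (splitAt m y)
    ; sym    = λ {x} {y} → sym⊎ (gr A) (gr B) (splitAt m x) (splitAt m y)
    ; irrefl = λ {x} → irr⊎ (gr A) (gr B) (splitAt m x) }
  ; Att = λ x → att⊎ (Att A) (Att B) (splitAt m x) }

emptyA : AGraph 0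
emptyA = record { gr = record { Adj = λ () ; sym = λ {} ; irrefl = λ {} } ; Att = λ () }

single : (T : Rooted) → AGraph (size T)
single T = record { gr = graph T ; Att = λ x → x ≡ root T }

joinAll : (Ts : List Rooted) → AGraph (sum (map size Ts))
joinAll []       = emptyA
joinAll (T ∷ Ts) = single T ⊕ joinAll Ts

-- add a new vertex v (= zero) adjacent exactly to the attachment vertices
private
  coneAdj : ∀ {n} → AGraph n → Fin (suc n) → Fin (suc n) → Set
  coneAdj A zero    zero    = ⊥
  coneAdj A zero    (suc y) = Att A y
  coneAdj A (suc x) zero    = Att A x
  coneAdj A (suc x) (suc y) = Adj (gr A) x y

  coneSym : ∀ {n} (A : AGraph n) x y → coneAdj A x y → coneAdj A y x
  coneSym A zero    (suc y) e = e
  coneSym A (suc x) zero    e = e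
  coneSym A (suc x) (suc y) e = sym (gr A) e

  coneIrr : ∀ {n} (A : AGraph n) x → ¬ coneAdj A x x
  coneIrr A zero    ()
  coneIrr A (suc x) e = irrefl (gr A) e

cone : ∀ {n} → AGraph n → Graph (suc n)
cone A = record { Adj = coneAdj A ; sym = λ {x} {y} → coneSym A x y ; irrefl = λ {x} → coneIrr A x }

Tstar : (T' T'' : Rooted) (Ts : List Rooted) →
        Graph (suc (sum (map size (T' ∷ T'' ∷ Ts))))
Tstar T' T'' Ts = cone (joinAll (T' ∷ T'' ∷ Ts))

-- Every R_g-cutset S of T* contains the new vertex v: otherwise a vertex outside S
-- that cannot reach v lies in a component confined to its own branch minus the root
-- of that branch, hence with at most g vertices. Once v ∈ S, every component of
-- T* − S lies inside one branch, so each branch T_i of order at most g lies entirely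
-- in S, and |S| ≥ 1 + Σ |V(T_i)| = n − 2g − 2. Conversely v together with all the
-- T_i is an R_g-cutset of exactly this size, leaving the components T' and T''.
module Submission where

open import Defs
open import Data.Nat using (ℕ; zero; suc; _≤_; _<_; z≤n; s≤s; _∸_; _*_; _≤?_; _≟_)
open import Data.Nat.Properties
  using (≤-refl; ≤-reflexive; ≤-trans; ≤-antisym; <-irrefl; n≤1+n; suc-injective; +-∸-assoc; *-comm; *-monoʳ-≤)
open import Data.Nat.DivMod using (_/_; m/n*n≤m)
open import Data.Fin using (Fin; zero; suc; splitAt; toℕ; fromℕ<; _↑ˡ_; _↑ʳ_)
open import Data.Fin.Properties
  using ( 0≢1+n; toℕ-injective; toℕ<n; toℕ-fromℕ<; splitAt-↑ˡ; splitAt-↑ʳ; splitAt⁻¹-↑ˡ; splitAt⁻¹-↑ʳ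
        ; ↑ˡ-injective; ↑ʳ-injective)
  renaming (suc-injective to Fin-suc-injective)
open import Data.Fin.Subset using (Subset; inside; outside; _∈_; _∉_; ∣_∣; _-_; ⊤)
open import Data.Fin.Subset.Properties
  using (_∈?_; ∈⊤; ∣⊤∣≡n; drop-there; x∈p∧x≢y⇒x∈p-y; x∈p⇒∣p-x∣<∣p∣)
open import Data.Vec using ([]; _∷_; here; there; tabulate)
open import Data.Vec.Properties using (lookup∘tabulate; []=⇒lookup; lookup⇒[]=)
open import Data.List using (List; []; _∷_; map)
open import Data.Nat.ListAction using (sum)
open import Data.List.Relation.Unary.All using (All; []; _∷_) renaming (map to All-map)
open import Data.Sum using (_⊎_; inj₁; inj₂)
open import Data.Product using (Σ; ∃; _×_; _,_; proj₁; proj₂)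
open import Data.Empty using (⊥-elim)
open import Function using (_∘_)
open import Relation.Nullary using (¬_; Dec; yes; no; does)
open import Relation.Nullary.Decidable using (dec-true)
open import Relation.Binary.PropositionalEquality
  using (_≡_; _≢_; refl; trans; cong; subst) renaming (sym to ≡-sym)

module _ {n} {G : Graph n} {S : Subset n} where

  Reach-source∉ : ∀ {x y} → Reach G S x y → x ∉ S
  Reach-source∉ (here x∉S)     = x∉S
  Reach-source∉ (step x∉S _ _) = x∉S

  Reach-target∉ : ∀ {x y} → Reach G S x y → y ∉ S
  Reach-target∉ (here y∉S)   = y∉S
  Reach-target∉ (step _ _ r) = Reach-target∉ r

  Reach-trans : ∀ {x y z} → Reach G S x y → Reach G S y z → Reach G S x z
  Reach-trans (here _)       s = s
  Reach-trans (step x∉S e r) s = step x∉S e (Reach-trans r s)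

  Reach-sym : ∀ {x y} → Reach G S x y → Reach G S y x
  Reach-sym (here x∉S)     = here x∉S
  Reach-sym (step x∉S e r) = Reach-trans (Reach-sym r) (step (Reach-source∉ r) (sym G e) (here x∉S))

Reach-map : ∀ {m k} {G : Graph m} {H : Graph k} {R : Subset m} {S : Subset k} (f : Fin m → Fin k) →
  (∀ {a b} → Adj G a b → Adj H (f a) (f b)) → (∀ a → f a ∉ S) →
  ∀ {a b} → Reach G R a b → Reach H S (f a) (f b)
Reach-map f f-Adj f∉S (here _)     = here (f∉S _)
Reach-map f f-Adj f∉S (step _ e r) = step (f∉S _) (f-Adj e) (Reach-map f f-Adj f∉S r)

injection⇒∣p∣≤∣q∣ : ∀ {m n} (p : Subset m) (q : Subset n) (f : ∀ x → x ∈ p → Fin n) →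
  (∀ x x∈p → f x x∈p ∈ q) → (∀ x y x∈p y∈p → f x x∈p ≡ f y y∈p → x ≡ y) →
  ∣ p ∣ ≤ ∣ q ∣
injection⇒∣p∣≤∣q∣ []            q f f∈q f-inj = z≤n
injection⇒∣p∣≤∣q∣ (outside ∷ p) q f f∈q f-inj =
  injection⇒∣p∣≤∣q∣ p q (λ x x∈p → f (suc x) (there x∈p)) (λ _ _ → f∈q _ _)
    (λ _ _ _ _ eq → Fin-suc-injective (f-inj _ _ _ _ eq))
injection⇒∣p∣≤∣q∣ {n = n} (inside ∷ p) q f f∈q f-inj =
  ≤-trans (s≤s ∣p∣≤∣q-f₀∣) (x∈p⇒∣p-x∣<∣p∣ (f∈q zero here))
  where
  f₀ : Fin n
  f₀ = f zero here
  ∣p∣≤∣q-f₀∣ : ∣ p ∣ ≤ ∣ q - f₀ ∣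
  ∣p∣≤∣q-f₀∣ = injection⇒∣p∣≤∣q∣ p (q - f₀) (λ x x∈p → f (suc x) (there x∈p))
    (λ _ _ → x∈p∧x≢y⇒x∈p-y (f∈q _ _) (λ eq → 0≢1+n (≡-sym (f-inj _ _ _ _ eq))))
    (λ _ _ _ _ eq → Fin-suc-injective (f-inj _ _ _ _ eq))

module _ {n} {P : Fin n → Set} (P? : ∀ x → Dec (P x)) where

  subset : Subset n
  subset = tabulate (does ∘ P?)

  ∈subset⁺ : ∀ {x} → P x → x ∈ subset
  ∈subset⁺ {x} px = lookup⇒[]= x subset (trans (lookup∘tabulate (does ∘ P?) x) (dec-true (P? x) px))

  ∈subset⁻ : ∀ {x} → x ∈ subset → P x
  ∈subset⁻ {x} x∈ with P? x | trans (≡-sym (lookup∘tabulate (does ∘ P?) x)) ([]=⇒lookup x∈)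
  ... | yes px | _ = px
  ... | no _   | ()

order : List Rooted → ℕ
order L = sum (map size L)

-- Block indices and offsets are kept in ℕ rather than in Fin (length L) and
-- Fin (size T), so that vertices of one block can be compared without transport.
block : (L : List Rooted) → Fin (order L) → ℕ
block (T ∷ L) x with splitAt (size T) x
... | inj₁ _ = 0
... | inj₂ y = suc (block L y)

offset : (L : List Rooted) → Fin (order L) → ℕ
offset (T ∷ L) x with splitAt (size T) x
... | inj₁ a = toℕ a
... | inj₂ y = offset L y

blockSize : List Rooted → ℕ → ℕ
blockSize []      _       = 0
blockSize (T ∷ L) zero    = size T
blockSize (T ∷ L) (suc b) = blockSize L b

blockRoot : List Rooted → ℕ → ℕ
blockRoot []      _       = 0
blockRoot (T ∷ L) zero    = toℕ (root T)
blockRoot (T ∷ L) (suc b) = blockRoot L b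

Adj⇒≡block : (L : List Rooted) (x y : Fin (order L)) → Adj (gr (joinAll L)) x y → block L x ≡ block L y
Adj⇒≡block (T ∷ L) x y e with splitAt (size T) x | splitAt (size T) y
... | inj₁ _ | inj₁ _ = refl
... | inj₂ a | inj₂ b = cong suc (Adj⇒≡block L a b e)

offset<blockSize : (L : List Rooted) (x : Fin (order L)) → offset L x < blockSize L (block L x)
offset<blockSize (T ∷ L) x with splitAt (size T) x
... | inj₁ a = toℕ<n a
... | inj₂ y = offset<blockSize L y

blockRoot<blockSize : (L : List Rooted) (x : Fin (order L)) → blockRoot L (block L x) < blockSize L (block L x)
blockRoot<blockSize (T ∷ L) x with splitAt (size T) x
... | inj₁ _ = toℕ<n (root T)
... | inj₂ y = blockRoot<blockSize L y

block-offset-injective : (L : List Rooted) (x y : Fin (order L)) →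
  block L x ≡ block L y → offset L x ≡ offset L y → x ≡ y
block-offset-injective (T ∷ L) x y ≡b ≡o with splitAt (size T) x in eqx | splitAt (size T) y in eqy
... | inj₁ a | inj₁ b = trans (≡-sym (splitAt⁻¹-↑ˡ eqx))
  (trans (cong (_↑ˡ order L) (toℕ-injective ≡o)) (splitAt⁻¹-↑ˡ eqy))
... | inj₂ a | inj₂ b = trans (≡-sym (splitAt⁻¹-↑ʳ eqx))
  (trans (cong (size T ↑ʳ_) (block-offset-injective L a b (suc-injective ≡b) ≡o)) (splitAt⁻¹-↑ʳ eqy))

offset≡blockRoot⇒Att : (L : List Rooted) (x : Fin (order L)) →
  offset L x ≡ blockRoot L (block L x) → Att (joinAll L) x
offset≡blockRoot⇒Att (T ∷ L) x eq with splitAt (size T) x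
... | inj₁ _ = toℕ-injective eq
... | inj₂ y = offset≡blockRoot⇒Att L y eq

block-↑ˡ : (T : Rooted) (L : List Rooted) (a : Fin (size T)) → block (T ∷ L) (a ↑ˡ order L) ≡ 0
block-↑ˡ T L a rewrite splitAt-↑ˡ (size T) a (order L) = refl

block-↑ʳ : (T : Rooted) (L : List Rooted) (x : Fin (order L)) →
  block (T ∷ L) (size T ↑ʳ x) ≡ suc (block L x)
block-↑ʳ T L x rewrite splitAt-↑ʳ (size T) (order L) x = refl

block≡0⇒↑ˡ : (T : Rooted) (L : List Rooted) (x : Fin (order (T ∷ L))) →
  block (T ∷ L) x ≡ 0 → ∃ λ a → x ≡ a ↑ˡ order L
block≡0⇒↑ˡ T L x _ with splitAt (size T) x in eq
... | inj₁ a = a , ≡-sym (splitAt⁻¹-↑ˡ eq)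

block≡suc⇒↑ʳ : (T : Rooted) (L : List Rooted) (x : Fin (order (T ∷ L))) {b : ℕ} →
  block (T ∷ L) x ≡ suc b → ∃ λ y → x ≡ size T ↑ʳ y × block L y ≡ b
block≡suc⇒↑ʳ T L x ≡b with splitAt (size T) x in eq
... | inj₂ y = y , ≡-sym (splitAt⁻¹-↑ʳ eq) , suc-injective ≡b

record BlockEmbedding (L : List Rooted) (T : Rooted) (b : ℕ) : Set where
  field
    embed           : Fin (size T) → Fin (order L)
    block-embed     : ∀ a → block L (embed a) ≡ b
    embed-onto      : ∀ x → block L x ≡ b → ∃ λ a → x ≡ embed a
    embed-Adj       : ∀ {a a'} → Adj (graph T) a a' → Adj (gr (joinAll L)) (embed a) (embed a')
    embed-injective : ∀ a a' → embed a ≡ embed a' → a ≡ a'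
open BlockEmbedding

headBlock : (T : Rooted) (L : List Rooted) → BlockEmbedding (T ∷ L) T 0
headBlock T L = record
  { embed           = _↑ˡ order L
  ; block-embed     = block-↑ˡ T L
  ; embed-onto      = block≡0⇒↑ˡ T L
  ; embed-Adj       = Adj-↑ˡ
  ; embed-injective = ↑ˡ-injective (order L)
  }
  where
  Adj-↑ˡ : ∀ {a a'} → Adj (graph T) a a' → Adj (gr (joinAll (T ∷ L))) (a ↑ˡ order L) (a' ↑ˡ order L)
  Adj-↑ˡ {a} {a'} e rewrite splitAt-↑ˡ (size T) a (order L) | splitAt-↑ˡ (size T) a' (order L) = e

tailBlock : ∀ {L T b} (U : Rooted) → BlockEmbedding L T b → BlockEmbedding (U ∷ L) T (suc b)
tailBlock {L} {T} {b} U E = record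
  { embed           = λ a → size U ↑ʳ embed E a
  ; block-embed     = λ a → trans (block-↑ʳ U L (embed E a)) (cong suc (block-embed E a))
  ; embed-onto      = onto
  ; embed-Adj       = Adj-↑ʳ
  ; embed-injective = λ a a' eq → embed-injective E a a' (↑ʳ-injective (size U) _ _ eq)
  }
  where
  onto : ∀ x → block (U ∷ L) x ≡ suc b → ∃ λ a → x ≡ size U ↑ʳ embed E a
  onto x ≡b with block≡suc⇒↑ʳ U L x ≡b
  ... | y , refl , ≡b' with embed-onto E y ≡b'
  ...   | a , refl = a , refl

  Adj-↑ʳ : ∀ {a a'} → Adj (graph T) a a' →
    Adj (gr (joinAll (U ∷ L))) (size U ↑ʳ embed E a) (size U ↑ʳ embed E a')
  Adj-↑ʳ {a} {a'} e
    rewrite splitAt-↑ʳ (size U) (order L) (embed E a) | splitAt-↑ʳ (size U) (order L) (embed E a') =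
    embed-Adj E e

SameBlock : (L : List Rooted) → Fin (order L) → Fin (suc (order L)) → Set
SameBlock L i y = ∃ λ j → y ≡ suc j × block L i ≡ block L j

Reach⇒SameBlock⊎ReachApex : (L : List Rooted) (S : Subset (suc (order L))) (i : Fin (order L))
  {y : Fin (suc (order L))} →
  Reach (cone (joinAll L)) S (suc i) y → SameBlock L i y ⊎ Reach (cone (joinAll L)) S (suc i) zero
Reach⇒SameBlock⊎ReachApex L S i (here _) = inj₁ (i , refl , refl)
Reach⇒SameBlock⊎ReachApex L S i (step {y = zero} i∉S e r) = inj₂ (step i∉S e (here (Reach-source∉ r)))
Reach⇒SameBlock⊎ReachApex L S i (step {y = suc k} i∉S e r) with Reach⇒SameBlock⊎ReachApex L S k r
... | inj₁ (j , refl , ≡b) = inj₁ (j , refl , trans (Adj⇒≡block L i k e) ≡b)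
... | inj₂ r'              = inj₂ (step i∉S e r')

-- C injects into the offsets of the block of i; if the apex survives, the root
-- offset is missed, since the root is adjacent to the apex.
module ComponentBound (L : List Rooted) (S : Subset (suc (order L))) (i : Fin (order L))
  (C : Subset (suc (order L))) (C-reach : ∀ y → y ∈ C → Reach (cone (joinAll L)) S (suc i) y)
  (¬reach-apex : ¬ Reach (cone (joinAll L)) S (suc i) zero) where

  private
    sameBlock : ∀ y → y ∈ C → SameBlock L i y
    sameBlock y y∈C with Reach⇒SameBlock⊎ReachApex L S i (C-reach y y∈C)
    ... | inj₁ same = same
    ... | inj₂ r    = ⊥-elim (¬reach-apex r)

    vertex : ∀ y → y ∈ C → Fin (order L)
    vertex y y∈C = proj₁ (sameBlock y y∈C)

    y≡ : ∀ y y∈C → y ≡ suc (vertex y y∈C)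
    y≡ y y∈C = proj₁ (proj₂ (sameBlock y y∈C))

    block≡ : ∀ y y∈C → block L i ≡ block L (vertex y y∈C)
    block≡ y y∈C = proj₂ (proj₂ (sameBlock y y∈C))

    offset< : ∀ y y∈C → offset L (vertex y y∈C) < blockSize L (block L i)
    offset< y y∈C = subst (λ b → offset L (vertex y y∈C) < blockSize L b) (≡-sym (block≡ y y∈C))
      (offset<blockSize L (vertex y y∈C))

    localIndex : ∀ y → y ∈ C → Fin (blockSize L (block L i))
    localIndex y y∈C = fromℕ< (offset< y y∈C)

    offset≡ : ∀ y y∈C → offset L (vertex y y∈C) ≡ toℕ (localIndex y y∈C)
    offset≡ y y∈C = ≡-sym (toℕ-fromℕ< (offset< y y∈C))

    localIndex-injective : ∀ y y' y∈C y'∈C → localIndex y y∈C ≡ localIndex y' y'∈C → y ≡ y'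
    localIndex-injective y y' y∈C y'∈C eq =
      trans (y≡ y y∈C)
        (trans (cong suc (block-offset-injective L (vertex y y∈C) (vertex y' y'∈C)
                  (trans (≡-sym (block≡ y y∈C)) (block≡ y' y'∈C))
                  (trans (offset≡ y y∈C) (trans (cong toℕ eq) (≡-sym (offset≡ y' y'∈C))))))
          (≡-sym (y≡ y' y'∈C)))

    rootIndex : Fin (blockSize L (block L i))
    rootIndex = fromℕ< (blockRoot<blockSize L i)

    localIndex≢rootIndex : zero ∉ S → ∀ y y∈C → localIndex y y∈C ≢ rootIndex
    localIndex≢rootIndex apex∉S y y∈C eq = ¬reach-apex (Reach-trans (C-reach y y∈C) (Reach-sym apex→y))
      where
      j : Fin (order L)
      j = vertex y y∈C
      offset≡root : offset L j ≡ blockRoot L (block L j)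
      offset≡root = trans (offset≡ y y∈C)
        (trans (cong toℕ eq)
          (trans (toℕ-fromℕ< (blockRoot<blockSize L i)) (cong (blockRoot L) (block≡ y y∈C))))
      apex→y : Reach (cone (joinAll L)) S zero y
      apex→y = subst (Reach (cone (joinAll L)) S zero) (≡-sym (y≡ y y∈C))
        (step apex∉S (offset≡blockRoot⇒Att L j offset≡root)
          (here (subst (_∉ S) (y≡ y y∈C) (Reach-target∉ (C-reach y y∈C)))))

  ∣C∣≤blockSize : ∣ C ∣ ≤ blockSize L (block L i)
  ∣C∣≤blockSize = subst (∣ C ∣ ≤_) (∣⊤∣≡n _)
    (injection⇒∣p∣≤∣q∣ C ⊤ localIndex (λ _ _ → ∈⊤) localIndex-injective)

  ∣C∣<blockSize : zero ∉ S → ∣ C ∣ < blockSize L (block L i)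
  ∣C∣<blockSize apex∉S = subst (suc ∣ C ∣ ≤_) (∣⊤∣≡n _)
    (≤-trans (s≤s (injection⇒∣p∣≤∣q∣ C (⊤ - rootIndex) localIndex
                    (λ y y∈C → x∈p∧x≢y⇒x∈p-y ∈⊤ (localIndex≢rootIndex apex∉S y y∈C))
                    localIndex-injective))
             (x∈p⇒∣p-x∣<∣p∣ {p = ⊤} (∈⊤ {x = rootIndex})))

blockComponent : ∀ {L T b} (E : BlockEmbedding L T b) → Connected (graph T) →
  (S : Subset (suc (order L))) → (∀ a → suc (embed E a) ∉ S) →
  ∀ a → Σ (Subset (suc (order L))) λ C →
    size T ≤ ∣ C ∣ × (∀ y → y ∈ C → Reach (cone (joinAll L)) S (suc (embed E a)) y)
blockComponent {L} {T} {b} E conn S embed∉S a = C , size≤∣C∣ , C-reach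
  where
  inBlock? : ∀ j → Dec (block L j ≡ b)
  inBlock? j = block L j ≟ b

  C : Subset (suc (order L))
  C = outside ∷ subset inBlock?

  size≤∣C∣ : size T ≤ ∣ C ∣
  size≤∣C∣ = subst (_≤ ∣ C ∣) (∣⊤∣≡n _)
    (injection⇒∣p∣≤∣q∣ ⊤ C (λ a' _ → suc (embed E a'))
      (λ a' _ → there (∈subset⁺ inBlock? (block-embed E a')))
      (λ a' a'' _ _ eq → embed-injective E a' a'' (Fin-suc-injective eq)))

  C-reach : ∀ y → y ∈ C → Reach (cone (joinAll L)) S (suc (embed E a)) y
  C-reach (suc j) y∈C with embed-onto E j (∈subset⁻ inBlock? (drop-there y∈C))
  ... | a' , refl = Reach-map (suc ∘ embed E) (embed-Adj E) embed∉S (conn a a')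

blockSize≤ : ∀ {g} {Ts : List Rooted} → All (λ T → size T ≤ g) Ts → ∀ b → blockSize Ts b ≤ g
blockSize≤ []         b       = z≤n
blockSize≤ (≤g ∷ _)   zero    = ≤g
blockSize≤ (_ ∷ ≤gs)  (suc b) = blockSize≤ ≤gs b

module TstarCutsets (g : ℕ) (T' T'' : Rooted) (Ts : List Rooted)
  (T'-size : size T' ≡ suc g) (T''-size : size T'' ≡ suc g) (Ts-small : ∀ b → blockSize Ts b ≤ g) where

  L : List Rooted
  L = T' ∷ T'' ∷ Ts

  G : Graph (suc (order L))
  G = Tstar T' T'' Ts

  blockSize≤1+g : ∀ b → blockSize L b ≤ suc g
  blockSize≤1+g zero          = ≤-reflexive T'-size
  blockSize≤1+g (suc zero)    = ≤-reflexive T''-size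
  blockSize≤1+g (suc (suc b)) = ≤-trans (Ts-small b) (n≤1+n g)

  large⇒block≤1 : ∀ b → suc g ≤ blockSize L b → b ≤ 1
  large⇒block≤1 zero          _  = z≤n
  large⇒block≤1 (suc zero)    _  = s≤s z≤n
  large⇒block≤1 (suc (suc b)) ≤s = ⊥-elim (<-irrefl refl (≤-trans ≤s (Ts-small b)))

  T'-block : BlockEmbedding L T' 0
  T'-block = headBlock T' (T'' ∷ Ts)

  T''-block : BlockEmbedding L T'' 1
  T''-block = tailBlock T' (headBlock T'' Ts)

  inTs : Fin (order Ts) → Fin (order L)
  inTs k = size T' ↑ʳ (size T'' ↑ʳ k)

  block-inTs : ∀ k → block L (inTs k) ≡ suc (suc (block Ts k))
  block-inTs k = trans (block-↑ʳ T' (T'' ∷ Ts) (size T'' ↑ʳ k)) (cong suc (block-↑ʳ T'' Ts k))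

  apex∈RgCutset : ∀ S → IsRgCutset g G S → zero ∈ S
  apex∈RgCutset S ((x , y , x∉S , y∉S , ¬x→y) , large) with zero ∈? S
  ... | yes apex∈S = apex∈S
  ... | no  apex∉S =
    ⊥-elim (¬¬reachApex x x∉S λ x→v →
            ¬¬reachApex y y∉S λ y→v → ¬x→y (Reach-trans x→v (Reach-sym y→v)))
    where
    ¬¬reachApex : ∀ w → w ∉ S → ¬ ¬ Reach G S w zero
    ¬¬reachApex zero    w∉S ¬w→v = ¬w→v (here w∉S)
    ¬¬reachApex (suc i) w∉S ¬w→v with large (suc i) w∉S
    ... | C , ∣C∣≥ , C-reach = <-irrefl refl
      (≤-trans (ComponentBound.∣C∣<blockSize L S i C C-reach ¬w→v apex∉S)
               (≤-trans (blockSize≤1+g (block L i)) ∣C∣≥))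

  1+order-Ts≤∣RgCutset∣ : ∀ S → IsRgCutset g G S → suc (order Ts) ≤ ∣ S ∣
  1+order-Ts≤∣RgCutset∣ S S-cutset@(_ , large) =
    subst (_≤ ∣ S ∣) (∣⊤∣≡n _) (injection⇒∣p∣≤∣q∣ ⊤ S f f∈S f-injective)
    where
    apex∈S : zero ∈ S
    apex∈S = apex∈RgCutset S S-cutset

    block≤1 : ∀ i → suc i ∉ S → block L i ≤ 1
    block≤1 i i∉S with large (suc i) i∉S
    ... | C , ∣C∣≥ , C-reach = large⇒block≤1 (block L i)
      (≤-trans ∣C∣≥ (ComponentBound.∣C∣≤blockSize L S i C C-reach (λ r → Reach-target∉ r apex∈S)))

    f : ∀ x → x ∈ ⊤ → Fin (suc (order L))
    f zero    _ = zero
    f (suc k) _ = suc (inTs k)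

    f∈S : ∀ x x∈⊤ → f x x∈⊤ ∈ S
    f∈S zero    _ = apex∈S
    f∈S (suc k) _ with suc (inTs k) ∈? S
    ... | yes k∈S = k∈S
    ... | no  k∉S with subst (_≤ 1) (block-inTs k) (block≤1 (inTs k) k∉S)
    ...   | s≤s ()

    f-injective : ∀ x y x∈ y∈ → f x x∈ ≡ f y y∈ → x ≡ y
    f-injective zero    zero    _ _ _  = refl
    f-injective zero    (suc _) _ _ ()
    f-injective (suc _) zero    _ _ ()
    f-injective (suc k) (suc l) _ _ eq =
      cong suc (↑ʳ-injective (size T'') k l (↑ʳ-injective (size T') _ _ (Fin-suc-injective eq)))

  inTs? : ∀ j → Dec (2 ≤ block L j)
  inTs? j = 2 ≤? block L j

  S₀ : Subset (suc (order L))
  S₀ = inside ∷ subset inTs?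

  S₀-isRgCutset : Connected (graph T') → Connected (graph T'') → IsRgCutset g G S₀
  S₀-isRgCutset T'-conn T''-conn = (r' , r'' , r'∉S₀ , r''∉S₀ , ¬r'→r'') , large
    where
    embed∉S₀ : ∀ {T b} (E : BlockEmbedding L T b) → b < 2 → ∀ a → suc (embed E a) ∉ S₀
    embed∉S₀ E b<2 a a∈S₀ = <-irrefl refl
      (≤-trans b<2 (subst (2 ≤_) (block-embed E a) (∈subset⁻ inTs? (drop-there a∈S₀))))

    r' r'' : Fin (suc (order L))
    r'  = suc (embed T'-block (root T'))
    r'' = suc (embed T''-block (root T''))
    r'∉S₀ : r' ∉ S₀
    r'∉S₀ = embed∉S₀ T'-block (s≤s z≤n) (root T')

    r''∉S₀ : r'' ∉ S₀
    r''∉S₀ = embed∉S₀ T''-block ≤-refl (root T'')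

    ¬r'→r'' : ¬ Reach G S₀ r' r''
    ¬r'→r'' r with Reach⇒SameBlock⊎ReachApex L S₀ (embed T'-block (root T')) r
    ... | inj₂ r→apex    = Reach-target∉ r→apex here
    ... | inj₁ (j , refl , ≡b)
      with trans (≡-sym (block-embed T'-block (root T'))) (trans ≡b (block-embed T''-block (root T'')))
    ...   | ()

    large : ∀ x → x ∉ S₀ → Σ (Subset _) λ C → (suc g ≤ ∣ C ∣) × (∀ y → y ∈ C → Reach G S₀ x y)
    large zero    apex∉S₀ = ⊥-elim (apex∉S₀ here)
    large (suc i) i∉S₀ with block L i in ≡b
    ... | zero with embed-onto T'-block i ≡b
    ...   | a , refl with blockComponent T'-block T'-conn S₀ (embed∉S₀ T'-block (s≤s z≤n)) a
    ...     | C , ≤∣C∣ , C-reach = C , subst (_≤ ∣ C ∣) T'-size ≤∣C∣ , C-reach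
    large (suc i) i∉S₀ | suc zero with embed-onto T''-block i ≡b
    ...   | a , refl with blockComponent T''-block T''-conn S₀ (embed∉S₀ T''-block ≤-refl) a
    ...     | C , ≤∣C∣ , C-reach = C , subst (_≤ ∣ C ∣) T''-size ≤∣C∣ , C-reach
    large (suc i) i∉S₀ | suc (suc b) =
      ⊥-elim (i∉S₀ (there (∈subset⁺ inTs? (subst (2 ≤_) (≡-sym ≡b) (s≤s (s≤s z≤n))))))

  ∣S₀∣≤1+order-Ts : ∣ S₀ ∣ ≤ suc (order Ts)
  ∣S₀∣≤1+order-Ts =
    subst (∣ S₀ ∣ ≤_) (∣⊤∣≡n _) (injection⇒∣p∣≤∣q∣ S₀ ⊤ f (λ _ _ → ∈⊤) f-injective)
    where
    fromTs : ∀ i → suc i ∈ S₀ → ∃ λ k → i ≡ inTs k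
    fromTs i i∈S₀ with block L i in ≡b | ∈subset⁻ inTs? (drop-there i∈S₀)
    ... | suc zero    | s≤s ()
    ... | suc (suc b) | _ with block≡suc⇒↑ʳ T' (T'' ∷ Ts) i ≡b
    ...   | j , refl , ≡b' with block≡suc⇒↑ʳ T'' Ts j ≡b'
    ...     | k , refl , _ = k , refl

    f : ∀ x → x ∈ S₀ → Fin (suc (order Ts))
    f zero    _    = zero
    f (suc i) i∈S₀ = suc (proj₁ (fromTs i i∈S₀))

    f-injective : ∀ x y x∈ y∈ → f x x∈ ≡ f y y∈ → x ≡ y
    f-injective zero    zero    _ _ _ = refl
    f-injective (suc i) (suc j) i∈ j∈ eq = cong suc
      (trans (proj₂ (fromTs i i∈)) (trans (cong inTs (Fin-suc-injective eq)) (≡-sym (proj₂ (fromTs j j∈)))))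

2g≤n∸3 : ∀ n g → g ≤ (n ∸ 3) / 2 → 2 * g ≤ n ∸ 3
2g≤n∸3 n g g≤ =
  ≤-trans (*-monoʳ-≤ 2 g≤) (subst (_≤ n ∸ 3) (*-comm ((n ∸ 3) / 2) 2) (m/n*n≤m (n ∸ 3) 2))

n∸2g∸2≡1+n∸2g∸3 : ∀ n g → 1 ≤ g → 2 * g ≤ n ∸ 3 → n ∸ 2 * g ∸ 2 ≡ suc (n ∸ 2 * g ∸ 3)
n∸2g∸2≡1+n∸2g∸3 (suc (suc (suc n))) g _ 2g≤ rewrite +-∸-assoc 3 2g≤ = refl
n∸2g∸2≡1+n∸2g∸3 zero                (suc g) _ ()
n∸2g∸2≡1+n∸2g∸3 (suc zero)          (suc g) _ ()
n∸2g∸2≡1+n∸2g∸3 (suc (suc zero))    (suc g) _ ()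

lemma4p1 : (n g : ℕ) → 1 ≤ g → g ≤ (n ∸ 3) / 2 →
    (T' T'' : Rooted) → IsTree (graph T') → IsTree (graph T'') →
    size T' ≡ suc g → size T'' ≡ suc g →
    (Ts : List Rooted) →
    All (λ T → IsTree (graph T) × 1 ≤ size T × size T ≤ g) Ts →
    sum (map size Ts) ≡ n ∸ 2 * g ∸ 3 →
    Kappa g (Tstar T' T'' Ts) (n ∸ 2 * g ∸ 2)
lemma4p1 n g 1≤g g≤ T' T'' T'-tree T''-tree T'-size T''-size Ts Ts-trees Ts-order =
  (S₀ , S₀-cutset , ≤-antisym (subst (∣ S₀ ∣ ≤_) κ≡ ∣S₀∣≤1+order-Ts) (minimal S₀ S₀-cutset)) , minimal
  where
  open TstarCutsets g T' T'' Ts T'-size T''-size (blockSize≤ (All-map (proj₂ ∘ proj₂) Ts-trees))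

  κ≡ : suc (order Ts) ≡ n ∸ 2 * g ∸ 2
  κ≡ = trans (cong suc Ts-order) (≡-sym (n∸2g∸2≡1+n∸2g∸3 n g 1≤g (2g≤n∸3 n g g≤)))

  S₀-cutset : IsRgCutset g (Tstar T' T'' Ts) S₀
  S₀-cutset = S₀-isRgCutset (proj₁ T'-tree) (proj₁ T''-tree)

  minimal : ∀ S → IsRgCutset g (Tstar T' T'' Ts) S → n ∸ 2 * g ∸ 2 ≤ ∣ S ∣
  minimal S S-cutset = subst (_≤ ∣ S ∣) κ≡ (1+order-Ts≤∣RgCutset∣ S S-cutset)
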